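{- For every integer $t\ge0$, the number of maximal totally isotropic subspaces of the bilinear space $\mathbf{H}^t$, and also the number of maximal totally isotropic subspaces of $\mathbf{I}^2\boxplus\mathbf{H}^t$, equals $$b(t)=2^{(t+1)t/2}\cdot\frac{(4)_t}{(2)_t}.$$
   Context: $\mathbf{I}=\mathbb{F}_2$ with form $b(x,y)=xy$; $\mathbf{H}=\mathbb{F}_2^2$ with form given by the matrix $\begin{pmatrix}0&1\\1&0\end{pmatrix}$; $\boxplus$ is the orthogonal direct sum and powers are iterated orthogonal sums. A subspace $S$ is totally isotropic if $b(x,y)=0$ for all $x,y\in S$; maximal totally isotropic means maximal among totally isotropic subspaces. $(q)_m=\prod_{i=1}^m(1-q^{ -i})$, $(q)_0=1$. -}

module Defs where

open import Data.Bool using (Bool; true; false; not; _∧_; _xor_; T)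
open import Data.Nat as ℕ using (ℕ; zero; suc; NonZero)
open import Data.Nat.Properties using (m^n≢0)
open import Data.Fin as Fin using (Fin; splitAt)
open import Data.Fin.Properties using (_≟_)
open import Data.Sum using (inj₁; inj₂)
open import Data.Vec using (Vec; []; _∷_; lookup; zipWith; replicate)
open import Data.List using (List; foldr; map; allFin; concatMap; length)
open import Data.List.Membership.Propositional using (_∈_)
open import Data.List.Relation.Unary.Unique.Propositional using (Unique)
open import Data.Product using (Σ; _×_; _,_)
open import Function.Bundles using (_⇔_)
open import Relation.Binary.PropositionalEquality using (_≡_)
open import Relation.Nullary.Decidable using (⌊_⌋)
open import Data.Integer using (+_)
open import Data.Rational using (ℚ; 1ℚ; _-_; _*_; _/_)

-- Bilinear spaces over F₂ = Bool (false = 0, true = 1, xor = +, ∧ = ·),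
-- given by a Gram matrix on the standard basis.

record BilSpace : Set where
  field
    dim  : ℕ
    gram : Fin dim → Fin dim → Bool
open BilSpace public

Vector : BilSpace → Set
Vector B = Vec Bool (dim B)

∑₂ : List Bool → Bool
∑₂ = foldr _xor_ false

form : (B : BilSpace) → Vector B → Vector B → Bool
form B x y = ∑₂ (concatMap (λ i → map (λ j → lookup x i ∧ (gram B i j ∧ lookup y j)) (allFin (dim B))) (allFin (dim B)))

𝐈 : BilSpace
𝐈 = record { dim = 1 ; gram = λ _ _ → true }

𝐇 : BilSpace
𝐇 = record { dim = 2 ; gram = λ i j → not ⌊ i ≟ j ⌋ }

𝟎 : BilSpace
𝟎 = record { dim = 0 ; gram = λ () }

_⊞_ : BilSpace → BilSpace → BilSpace
B ⊞ C = record
  { dim  = dim B ℕ.+ dim C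
  ; gram = λ i j → g (splitAt (dim B) i) (splitAt (dim B) j) }
  where
  g : _ → _ → Bool
  g (inj₁ i) (inj₁ j) = gram B i j
  g (inj₂ i) (inj₂ j) = gram C i j
  g (inj₁ _) (inj₂ _) = false
  g (inj₂ _) (inj₁ _) = false
infixr 6 _⊞_

_^⊞_ : BilSpace → ℕ → BilSpace
B ^⊞ zero  = 𝟎
B ^⊞ suc t = B ⊞ (B ^⊞ t)
infixr 8 _^⊞_

-- Subsets of F₂^n, represented canonically as binary tries
-- (characteristic function tabulated), so that ≡ is set equality.

Subset : ℕ → Set
Subset zero    = Bool
Subset (suc n) = Subset n × Subset n

member : ∀ {n} → Vec Bool n → Subset n → Bool
member []          b       = b
member (false ∷ x) (l , _) = member x l
member (true  ∷ x) (_ , r) = member x r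

_∈ˢ_ : ∀ {n} → Vec Bool n → Subset n → Set
x ∈ˢ S = T (member x S)

_⊆ˢ_ : ∀ {n} → Subset n → Subset n → Set
S ⊆ˢ S' = ∀ x → x ∈ˢ S → x ∈ˢ S'

-- linear subspace of F₂^n: contains 0 and closed under addition
-- (scalar multiplication over F₂ is then automatic)
IsSubspace : ∀ {n} → Subset n → Set
IsSubspace {n} S =
  (replicate n false ∈ˢ S) ×
  (∀ x y → x ∈ˢ S → y ∈ˢ S → zipWith _xor_ x y ∈ˢ S)

IsTotallyIsotropic : (B : BilSpace) → Subset (dim B) → Set
IsTotallyIsotropic B S =
  IsSubspace S × (∀ x y → x ∈ˢ S → y ∈ˢ S → form B x y ≡ false)

IsMaxTotallyIsotropic : (B : BilSpace) → Subset (dim B) → Set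
IsMaxTotallyIsotropic B S =
  IsTotallyIsotropic B S ×
  (∀ S' → IsTotallyIsotropic B S' → S ⊆ˢ S' → S' ≡ S)

HasCount : ∀ {n} → (Subset n → Set) → ℕ → Set
HasCount {n} P N =
  Σ (List (Subset n)) λ L → Unique L × (∀ S → (S ∈ L) ⇔ P S) × length L ≡ N

qPoch : (q : ℕ) → .{{NonZero q}} → ℕ → ℚ
qPoch q zero    = 1ℚ
qPoch q (suc m) = qPoch q m * (1ℚ - ((+ 1) / (q ℕ.^ suc m)) {{m^n≢0 q (suc m)}})

twoPowTri : ℕ → ℚ
twoPowTri t = (+ (2 ℕ.^ ((suc t ℕ.* t) ℕ./ 2))) / 1

ℕ→ℚ : ℕ → ℚ
ℕ→ℚ N = (+ N) / 1

-- Over 𝔽₂ the form of 𝐇^t is the standard symplectic form ω, so its maximal totally isotropic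
-- subspaces are its Lagrangians L = L^⊥. Write 𝐇^(t+1) = 𝐇 ⊞ 𝐇^t with e, f the basis of 𝐇.
-- Projecting L ∩ e^⊥ to 𝐇^t gives a Lagrangian Q of 𝐇^t, and L is recovered from Q and one of
-- 1 + 2·2^t choices: either e ∈ L, or L ∩ (f + 𝐇^t) ∋ a e + f + n for a unique a ∈ 𝔽₂ and a
-- unique representative n of a class of 𝐇^t / Q. Hence there are ∏_{i=1}^t (2^i + 1) Lagrangians,
-- and this is 2^{t(t+1)/2} (4)_t / (2)_t because (1 + 2^i)(1 - 2^{-i}) = 2^i (1 - 4^{-i}).
-- In 𝐈 ⊞ 𝐈 ⊞ 𝐇^t a vector (p, q, v) is isotropic iff p = q, and (1, 1, 0) is orthogonal to all
-- isotropic vectors, so the maximal totally isotropic subspaces are the {(p, p, v) | v ∈ L}.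

module Submission where

open import Data.Bool using (Bool; true; false; not; _∧_; _∨_; _xor_; T)
open import Data.Bool.Solver using (module xor-∧-Solver)
open import Data.Bool.Properties
  using (¬-not; _≟_; ∧-idem; ∧-zeroʳ; xor-assoc; xor-identityʳ; xor-same)
open import Data.Empty using (⊥-elim)
open import Data.Fin using (Fin; zero; suc; _↑ˡ_; _↑ʳ_)
open import Data.Fin.Properties using (splitAt-↑ˡ; splitAt-↑ʳ)
open import Data.Integer as ℤ using (+_)
import Data.Integer.Properties as ℤ
open import Data.List using (List; []; _∷_; _++_; map; allFin; concatMap; length; cartesianProductWith; cartesianProduct)
open import Data.List.Properties using (map-tabulate; length-map; length-++)
open import Data.List.Membership.Propositional using (_∈_; lose)
open import Data.List.Membership.Propositional.Properties
  using (∈-cartesianProductWith⁺; ∈-cartesianProduct⁺; ∈-map⁺; ∈-map⁻)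
import Data.List.Relation.Unary.All as All
import Data.List.Relation.Unary.All.Properties as All
open import Data.List.Relation.Unary.AllPairs using ([]; _∷_)
open import Data.List.Relation.Unary.Any using (here; there; any?; satisfied)
open import Data.List.Relation.Unary.Unique.Propositional using (Unique)
import Data.List.Relation.Unary.Unique.Propositional.Properties as Unique
open import Data.Maybe using (Maybe; just; nothing)
open import Data.Maybe.Properties using (just-injective)
open import Data.Nat using (ℕ; zero; suc; _+_; _^_; NonZero; pred)
import Data.Nat as ℕ
import Data.Nat.DivMod as ℕ
import Data.Nat.Properties as ℕ
open import Data.Nat.Divisibility using (divides)
open import Data.Nat.Tactic.RingSolver using () renaming (solve-∀ to solve-ℕ)
open import Data.Product using (Σ; _×_; _,_; proj₁; proj₂)
open import Data.Rational using (1ℚ; _*_; toℚᵘ)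
import Data.Rational as ℚ
import Data.Rational.Properties as ℚ
open import Data.Rational.Solver using (module +-*-Solver)
open import Data.Rational.Properties using (toℚᵘ-injective; toℚᵘ-fromℚᵘ; toℚᵘ-homo-+; toℚᵘ-homo-*)
open import Data.Rational.Unnormalised as ℚᵘ using (mkℚᵘ; *≡*) renaming (_≃_ to _≃ᵘ_)
import Data.Rational.Unnormalised.Properties as ℚᵘ
open import Data.Sum using (_⊎_; inj₁; inj₂)
open import Data.Unit using (⊤; tt)
open import Data.Vec as Vec using (Vec; []; _∷_; lookup; zipWith; replicate)
open import Data.Vec.Properties
  using (∷-injective; lookup-++ˡ; lookup-++ʳ; zipWith-assoc; zipWith-identityˡ; zipWith-identityʳ)
open import Function using (_∘_)
open import Function.Bundles using (_⇔_; mk⇔; Equivalence)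
open import Relation.Binary.PropositionalEquality
open import Relation.Nullary using (¬_; Dec; yes; no)
open import Relation.Nullary.Decidable using (T?; ⌊_⌋; toWitness; fromWitness; map′; _×-dec_; _⊎-dec_)
open import Relation.Unary using (Decidable)

open import Defs

-- Vectors over 𝔽₂

infixl 6 _⊕_
_⊕_ : ∀ {n} → Vec Bool n → Vec Bool n → Vec Bool n
_⊕_ = zipWith _xor_

0ᵛ : ∀ {n} → Vec Bool n
0ᵛ = replicate _ false

infixr 7 _·_
_·_ : ∀ {n} → Bool → Vec Bool n → Vec Bool n
false · v = 0ᵛ
true  · v = v

⊕-assoc : ∀ {n} (u v w : Vec Bool n) → (u ⊕ v) ⊕ w ≡ u ⊕ (v ⊕ w)
⊕-assoc = zipWith-assoc xor-assoc

⊕-identityʳ : ∀ {n} (u : Vec Bool n) → u ⊕ 0ᵛ ≡ u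
⊕-identityʳ = zipWith-identityʳ xor-identityʳ

⊕-self : ∀ {n} (u : Vec Bool n) → u ⊕ u ≡ 0ᵛ
⊕-self []      = refl
⊕-self (a ∷ u) = cong₂ _∷_ (xor-same a) (⊕-self u)

⊕-interchange : ∀ {n} (u v w z : Vec Bool n) → (u ⊕ v) ⊕ (w ⊕ z) ≡ (u ⊕ w) ⊕ (v ⊕ z)
⊕-interchange []      []      []      []      = refl
⊕-interchange (a ∷ u) (b ∷ v) (c ∷ w) (d ∷ z) = cong₂ _∷_ (interchange a b c d) (⊕-interchange u v w z)
  where
  open xor-∧-Solver
  interchange : ∀ a b c d → (a xor b) xor (c xor d) ≡ (a xor c) xor (b xor d)
  interchange = solve 4 (λ a b c d → (a :+ b) :+ (c :+ d) := (a :+ c) :+ (b :+ d)) refl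

⊕-cancel : ∀ {n} (u v w : Vec Bool n) → (u ⊕ w) ⊕ (v ⊕ w) ≡ u ⊕ v
⊕-cancel []      []      []      = refl
⊕-cancel (a ∷ u) (b ∷ v) (c ∷ w) = cong₂ _∷_ (cancel a b c) (⊕-cancel u v w)
  where
  open xor-∧-Solver
  cancel : ∀ a b c → (a xor c) xor (b xor c) ≡ a xor b
  cancel = solve 3 (λ a b c → (a :+ c) :+ (b :+ c) := a :+ b) refl

·-distrib-xor : ∀ {n} y y' (v : Vec Bool n) → (y xor y') · v ≡ y · v ⊕ y' · v
·-distrib-xor false y' v = sym (zipWith-identityˡ (λ _ → refl) (y' · v))
·-distrib-xor true false v = sym (⊕-identityʳ v)
·-distrib-xor true true  v = sym (⊕-self v)

⊕-·-interchange : ∀ {n} (u v : Vec Bool n) y y' w → (u ⊕ v) ⊕ (y xor y') · w ≡ (u ⊕ y · w) ⊕ (v ⊕ y' · w)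
⊕-·-interchange u v y y' w = trans (cong ((u ⊕ v) ⊕_) (·-distrib-xor y y' w)) (⊕-interchange u v (y · w) (y' · w))

⊕-cancelʳ : ∀ {n} (u v : Vec Bool n) → (u ⊕ v) ⊕ v ≡ u
⊕-cancelʳ u v = trans (⊕-assoc u v v) (trans (cong (u ⊕_) (⊕-self v)) (⊕-identityʳ u))

module SymmetricBilinear {n} (β : Vec Bool n → Vec Bool n → Bool)
  (β-sym : ∀ u v → β u v ≡ β v u) (β-linˡ : ∀ u v w → β (u ⊕ v) w ≡ β u w xor β v w) where

  β-linʳ : ∀ u v w → β u (v ⊕ w) ≡ β u v xor β u w
  β-linʳ u v w = begin
    β u (v ⊕ w)         ≡⟨ β-sym u (v ⊕ w) ⟩
    β (v ⊕ w) u         ≡⟨ β-linˡ v w u ⟩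
    β v u xor β w u     ≡⟨ cong₂ _xor_ (β-sym v u) (β-sym w u) ⟩
    β u v xor β u w     ∎
    where open ≡-Reasoning

  β-zeroʳ : ∀ u → β u 0ᵛ ≡ false
  β-zeroʳ u = begin
    β u 0ᵛ                ≡⟨ cong (β u) (sym (⊕-self 0ᵛ)) ⟩
    β u (0ᵛ ⊕ 0ᵛ)         ≡⟨ β-linʳ u 0ᵛ 0ᵛ ⟩
    β u 0ᵛ xor β u 0ᵛ     ≡⟨ xor-same (β u 0ᵛ) ⟩
    false                 ∎
    where open ≡-Reasoning

  β-zeroˡ : ∀ u → β 0ᵛ u ≡ false
  β-zeroˡ u = trans (β-sym 0ᵛ u) (β-zeroʳ u)

  β-·ʳ : ∀ u y v → β u (y · v) ≡ y ∧ β u v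
  β-·ʳ u false v = β-zeroʳ u
  β-·ʳ u true  v = refl

  β-·ˡ : ∀ y u v → β (y · u) v ≡ y ∧ β u v
  β-·ˡ false u v = β-zeroˡ v
  β-·ˡ true  u v = refl

  β-shift : ∀ {w} → β w w ≡ false → ∀ u v y y' →
    β (u ⊕ y · w) (v ⊕ y' · w) ≡ (β u v xor (y' ∧ β w u)) xor (y ∧ β w v)
  β-shift {w} ww u v y y' = begin
    β (u ⊕ y · w) (v ⊕ y' · w)
      ≡⟨ β-linˡ u (y · w) (v ⊕ y' · w) ⟩
    β u (v ⊕ y' · w) xor β (y · w) (v ⊕ y' · w)
      ≡⟨ cong₂ _xor_ (β-linʳ u v (y' · w)) (β-sym (y · w) (v ⊕ y' · w)) ⟩
    (β u v xor β u (y' · w)) xor β (v ⊕ y' · w) (y · w)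
      ≡⟨ cong₂ (λ p q → (β u v xor p) xor q) (β-·ʳ u y' w) (β-·ʳ (v ⊕ y' · w) y w) ⟩
    (β u v xor (y' ∧ β u w)) xor (y ∧ β (v ⊕ y' · w) w)
      ≡⟨ cong₂ (λ p q → (β u v xor (y' ∧ p)) xor (y ∧ q)) (β-sym u w) (β-linˡ v (y' · w) w) ⟩
    (β u v xor (y' ∧ β w u)) xor (y ∧ (β v w xor β (y' · w) w))
      ≡⟨ cong₂ (λ p q → (β u v xor (y' ∧ β w u)) xor (y ∧ (p xor q)))
               (β-sym v w) (trans (β-sym (y' · w) w) (trans (β-·ʳ w y' w) (cong (y' ∧_) ww))) ⟩
    (β u v xor (y' ∧ β w u)) xor (y ∧ (β w v xor (y' ∧ false)))
      ≡⟨ drop-square (β u v) (β w u) (β w v) y y' ⟩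
    (β u v xor (y' ∧ β w u)) xor (y ∧ β w v) ∎
    where
    open xor-∧-Solver
    open ≡-Reasoning
    drop-square : ∀ r p q y y' → (r xor (y' ∧ p)) xor (y ∧ (q xor (y' ∧ false))) ≡ (r xor (y' ∧ p)) xor (y ∧ q)
    drop-square = solve 5 (λ r p q y y' →
        (r :+ (y' :* p)) :+ (y :* (q :+ (y' :* con false))) :=
        (r :+ (y' :* p)) :+ (y :* q)) refl

-- Gram forms of orthogonal sums

∑₂-++ : ∀ xs ys → ∑₂ (xs ++ ys) ≡ ∑₂ xs xor ∑₂ ys
∑₂-++ []       ys = refl
∑₂-++ (x ∷ xs) ys = trans (cong (x xor_) (∑₂-++ xs ys)) (sym (xor-assoc x (∑₂ xs) (∑₂ ys)))

∑₂-concatMap : ∀ {A : Set} (g : A → List Bool) xs → ∑₂ (concatMap g xs) ≡ ∑₂ (map (∑₂ ∘ g) xs)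
∑₂-concatMap g []       = refl
∑₂-concatMap g (x ∷ xs) = trans (∑₂-++ (g x) (concatMap g xs)) (cong (∑₂ (g x) xor_) (∑₂-concatMap g xs))

sum₂ : ∀ n → (Fin n → Bool) → Bool
sum₂ n f = ∑₂ (map f (allFin n))

sum₂-suc : ∀ n f → sum₂ (suc n) f ≡ f zero xor sum₂ n (f ∘ suc)
sum₂-suc n f = cong (λ xs → f zero xor ∑₂ xs)
  (trans (map-tabulate suc f) (sym (map-tabulate (λ i → i) (f ∘ suc))))

sum₂-cong : ∀ n {f g} → (∀ i → f i ≡ g i) → sum₂ n f ≡ sum₂ n g
sum₂-cong zero    f≗g = refl
sum₂-cong (suc n) {f} {g} f≗g = begin
  sum₂ (suc n) f           ≡⟨ sum₂-suc n f ⟩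
  f zero xor sum₂ n (f ∘ suc) ≡⟨ cong₂ _xor_ (f≗g zero) (sum₂-cong n (f≗g ∘ suc)) ⟩
  g zero xor sum₂ n (g ∘ suc) ≡⟨ sym (sum₂-suc n g) ⟩
  sum₂ (suc n) g           ∎
  where open ≡-Reasoning

sum₂-zero : ∀ n {f} → (∀ i → f i ≡ false) → sum₂ n f ≡ false
sum₂-zero zero    f≗0 = refl
sum₂-zero (suc n) {f} f≗0 = begin
  sum₂ (suc n) f              ≡⟨ sum₂-suc n f ⟩
  f zero xor sum₂ n (f ∘ suc) ≡⟨ cong₂ _xor_ (f≗0 zero) (sum₂-zero n (f≗0 ∘ suc)) ⟩
  false                       ∎
  where open ≡-Reasoning

sum₂-+ : ∀ m n f → sum₂ (m + n) f ≡ sum₂ m (f ∘ (_↑ˡ n)) xor sum₂ n (f ∘ (m ↑ʳ_))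
sum₂-+ zero    n f = refl
sum₂-+ (suc m) n f = begin
  sum₂ (suc m + n) f
    ≡⟨ sum₂-suc (m + n) f ⟩
  f zero xor sum₂ (m + n) (f ∘ suc)
    ≡⟨ cong (f zero xor_) (sum₂-+ m n (f ∘ suc)) ⟩
  f zero xor (sum₂ m (f ∘ suc ∘ (_↑ˡ n)) xor sum₂ n (f ∘ (suc m ↑ʳ_)))
    ≡⟨ sym (xor-assoc (f zero) _ _) ⟩
  (f zero xor sum₂ m (f ∘ suc ∘ (_↑ˡ n))) xor sum₂ n (f ∘ (suc m ↑ʳ_))
    ≡⟨ cong (_xor sum₂ n (f ∘ (suc m ↑ʳ_))) (sym (sum₂-suc m (f ∘ (_↑ˡ n)))) ⟩
  sum₂ (suc m) (f ∘ (_↑ˡ n)) xor sum₂ n (f ∘ (suc m ↑ʳ_)) ∎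
  where open ≡-Reasoning

form-sum : ∀ B x y → form B x y ≡ sum₂ (dim B) (λ i → sum₂ (dim B) (λ j → lookup x i ∧ (gram B i j ∧ lookup y j)))
form-sum B x y = ∑₂-concatMap _ (allFin (dim B))

form-⊞ : ∀ B C (x x' : Vector B) (y y' : Vector C) →
         form (B ⊞ C) (x Vec.++ y) (x' Vec.++ y') ≡ form B x x' xor form C y y'
form-⊞ B C x x' y y' = begin
  form (B ⊞ C) (x Vec.++ y) (x' Vec.++ y')
    ≡⟨ form-sum (B ⊞ C) (x Vec.++ y) (x' Vec.++ y') ⟩
  sum₂ (m + n) (λ i → sum₂ (m + n) (entry i))
    ≡⟨ sum₂-+ m n _ ⟩
  sum₂ m (λ i → sum₂ (m + n) (entry (i ↑ˡ n))) xor sum₂ n (λ i → sum₂ (m + n) (entry (m ↑ʳ i)))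
    ≡⟨ cong₂ _xor_ (sum₂-cong m rowB) (sum₂-cong n rowC) ⟩
  sum₂ m (λ i → sum₂ m (λ j → lookup x i ∧ (gram B i j ∧ lookup x' j))) xor
  sum₂ n (λ i → sum₂ n (λ j → lookup y i ∧ (gram C i j ∧ lookup y' j)))
    ≡⟨ sym (cong₂ _xor_ (form-sum B x x') (form-sum C y y')) ⟩
  form B x x' xor form C y y' ∎
  where
  open ≡-Reasoning
  m = dim B
  n = dim C
  entry : Fin (m + n) → Fin (m + n) → Bool
  entry i j = lookup (x Vec.++ y) i ∧ (gram (B ⊞ C) i j ∧ lookup (x' Vec.++ y') j)
  rowB : ∀ i → sum₂ (m + n) (entry (i ↑ˡ n)) ≡ sum₂ m (λ j → lookup x i ∧ (gram B i j ∧ lookup x' j))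
  rowB i = begin
    sum₂ (m + n) (entry (i ↑ˡ n))
      ≡⟨ sum₂-+ m n _ ⟩
    sum₂ m (entry (i ↑ˡ n) ∘ (_↑ˡ n)) xor sum₂ n (entry (i ↑ˡ n) ∘ (m ↑ʳ_))
      ≡⟨ cong₂ _xor_ (sum₂-cong m diagonal) (sum₂-zero n off-diagonal) ⟩
    sum₂ m (λ j → lookup x i ∧ (gram B i j ∧ lookup x' j)) xor false
      ≡⟨ xor-identityʳ _ ⟩
    sum₂ m (λ j → lookup x i ∧ (gram B i j ∧ lookup x' j)) ∎
    where
    diagonal : ∀ j → entry (i ↑ˡ n) (j ↑ˡ n) ≡ lookup x i ∧ (gram B i j ∧ lookup x' j)
    diagonal j rewrite lookup-++ˡ x y i | lookup-++ˡ x' y' j | splitAt-↑ˡ m i n | splitAt-↑ˡ m j n = refl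
    off-diagonal : ∀ j → entry (i ↑ˡ n) (m ↑ʳ j) ≡ false
    off-diagonal j rewrite splitAt-↑ˡ m i n | splitAt-↑ʳ m n j = ∧-zeroʳ _
  rowC : ∀ i → sum₂ (m + n) (entry (m ↑ʳ i)) ≡ sum₂ n (λ j → lookup y i ∧ (gram C i j ∧ lookup y' j))
  rowC i = begin
    sum₂ (m + n) (entry (m ↑ʳ i))
      ≡⟨ sum₂-+ m n _ ⟩
    sum₂ m (entry (m ↑ʳ i) ∘ (_↑ˡ n)) xor sum₂ n (entry (m ↑ʳ i) ∘ (m ↑ʳ_))
      ≡⟨ cong₂ _xor_ (sum₂-zero m off-diagonal) (sum₂-cong n diagonal) ⟩
    sum₂ n (λ j → lookup y i ∧ (gram C i j ∧ lookup y' j)) ∎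
    where
    diagonal : ∀ j → entry (m ↑ʳ i) (m ↑ʳ j) ≡ lookup y i ∧ (gram C i j ∧ lookup y' j)
    diagonal j rewrite lookup-++ʳ x y i | lookup-++ʳ x' y' j | splitAt-↑ʳ m n i | splitAt-↑ʳ m n j = refl
    off-diagonal : ∀ j → entry (m ↑ʳ i) (j ↑ˡ n) ≡ false
    off-diagonal j rewrite splitAt-↑ʳ m n i | splitAt-↑ˡ m j n = ∧-zeroʳ _

V : ℕ → Set
V t = Vector (𝐇 ^⊞ t)

ω : ∀ t → V t → V t → Bool
ω zero    []          []            = false
ω (suc t) (x ∷ y ∷ v) (x' ∷ y' ∷ v') = ((x ∧ y') xor (y ∧ x')) xor ω t v v'

form-𝐇 : ∀ x y x' y' → form 𝐇 (x ∷ y ∷ []) (x' ∷ y' ∷ []) ≡ (x ∧ y') xor (y ∧ x')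
form-𝐇 = expand
  where
  open xor-∧-Solver
  -- the left-hand side is the normal form of form 𝐇 on these vectors
  expand : ∀ x y x' y' →
    (x ∧ false) xor ((x ∧ y') xor ((y ∧ x') xor ((y ∧ false) xor false))) ≡ (x ∧ y') xor (y ∧ x')
  expand = solve 4 (λ x y x' y' →
      (x :* con false) :+ ((x :* y') :+ ((y :* x') :+ ((y :* con false) :+ con false))) :=
      (x :* y') :+ (y :* x')) refl

form-𝐇^⊞ : ∀ t u v → form (𝐇 ^⊞ t) u v ≡ ω t u v
form-𝐇^⊞ zero    []          []            = refl
form-𝐇^⊞ (suc t) (x ∷ y ∷ v) (x' ∷ y' ∷ v') =
  trans (form-⊞ 𝐇 (𝐇 ^⊞ t) (x ∷ y ∷ []) (x' ∷ y' ∷ []) v v')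
        (cong₂ _xor_ (form-𝐇 x y x' y') (form-𝐇^⊞ t v v'))

ω-sym : ∀ t u v → ω t u v ≡ ω t v u
ω-sym zero    []          []            = refl
ω-sym (suc t) (x ∷ y ∷ v) (x' ∷ y' ∷ v') = cong₂ _xor_ (swap x y x' y') (ω-sym t v v')
  where
  open xor-∧-Solver
  swap : ∀ x y x' y' → (x ∧ y') xor (y ∧ x') ≡ (x' ∧ y) xor (y' ∧ x)
  swap = solve 4 (λ x y x' y' → (x :* y') :+ (y :* x') := (x' :* y) :+ (y' :* x)) refl

ω-linˡ : ∀ t u v w → ω t (u ⊕ v) w ≡ ω t u w xor ω t v w
ω-linˡ zero    []          []            []            = refl
ω-linˡ (suc t) (x ∷ y ∷ u) (x' ∷ y' ∷ v) (x'' ∷ y'' ∷ w) rewrite ω-linˡ t u v w =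
  lin x y x' y' x'' y'' (ω t u w) (ω t v w)
  where
  open xor-∧-Solver
  lin : ∀ x y x' y' x'' y'' p q →
    (((x xor x') ∧ y'') xor ((y xor y') ∧ x'')) xor (p xor q) ≡
    (((x ∧ y'') xor (y ∧ x'')) xor p) xor (((x' ∧ y'') xor (y' ∧ x'')) xor q)
  lin = solve 8 (λ x y x' y' x'' y'' p q →
      (((x :+ x') :* y'') :+ ((y :+ y') :* x'')) :+ (p :+ q) :=
      (((x :* y'') :+ (y :* x'')) :+ p) :+ (((x' :* y'') :+ (y' :* x'')) :+ q)) refl

ω-self : ∀ t u → ω t u u ≡ false
ω-self zero    []          = refl
ω-self (suc t) (x ∷ y ∷ u) rewrite ω-self t u = alternating x y
  where
  open xor-∧-Solver
  alternating : ∀ x y → ((x ∧ y) xor (y ∧ x)) xor false ≡ false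
  alternating = solve 2 (λ x y → ((x :* y) :+ (y :* x)) :+ con false := con false) refl

module Ω (t : ℕ) = SymmetricBilinear (ω t) (ω-sym t) (ω-linˡ t)

⇔-to : ∀ {A B : Set} → A ⇔ B → A → B
⇔-to = Equivalence.to

⇔-from : ∀ {A B : Set} → A ⇔ B → B → A
⇔-from = Equivalence.from

∃-Bool? : ∀ {P : Bool → Set} → (∀ b → Dec (P b)) → Dec (Σ Bool P)
∃-Bool? P? = map′ (λ { (inj₁ p) → false , p ; (inj₂ p) → true , p })
                  (λ { (false , p) → inj₁ p ; (true , p) → inj₂ p })
                  (P? false ⊎-dec P? true)

toSubset : ∀ {n} {P : Vec Bool n → Set} → Decidable P → Subset n
toSubset {zero}  P? = ⌊ P? [] ⌋
toSubset {suc n} P? = toSubset (P? ∘ (false ∷_)) , toSubset (P? ∘ (true ∷_))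

∈-toSubset : ∀ {n} {P : Vec Bool n → Set} (P? : Decidable P) x → x ∈ˢ toSubset P? ⇔ P x
∈-toSubset P? []          = mk⇔ toWitness fromWitness
∈-toSubset P? (false ∷ x) = ∈-toSubset (P? ∘ (false ∷_)) x
∈-toSubset P? (true  ∷ x) = ∈-toSubset (P? ∘ (true ∷_)) x

Subset-ext : ∀ {n} {S S' : Subset n} → (∀ x → x ∈ˢ S → x ∈ˢ S') → (∀ x → x ∈ˢ S' → x ∈ˢ S) → S ≡ S'
Subset-ext {zero}  S⊆S' S'⊆S = T-ext (S⊆S' []) (S'⊆S [])
  where
  T-ext : ∀ {a b} → (T a → T b) → (T b → T a) → a ≡ b
  T-ext {true}  {true}  _   _   = refl
  T-ext {true}  {false} a⇒b _   = ⊥-elim (a⇒b _)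
  T-ext {false} {true}  _   b⇒a = ⊥-elim (b⇒a _)
  T-ext {false} {false} _   _   = refl
Subset-ext {suc n} S⊆S' S'⊆S = cong₂ _,_ (Subset-ext (S⊆S' ∘ (false ∷_)) (S'⊆S ∘ (false ∷_)))
                                         (Subset-ext (S⊆S' ∘ (true ∷_)) (S'⊆S ∘ (true ∷_)))

≡-toSubset : ∀ {n} {S : Subset n} {P : Vec Bool n → Set} (P? : Decidable P) →
             (∀ x → x ∈ˢ S → P x) → (∀ x → P x → x ∈ˢ S) → S ≡ toSubset P?
≡-toSubset P? S⊆P P⊆S = Subset-ext (λ x x∈S → ⇔-from (∈-toSubset P? x) (S⊆P x x∈S))
                                   (λ x x∈P → P⊆S x (⇔-to (∈-toSubset P? x) x∈P))

-- Maximal totally isotropic subspaces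

IsCoisotropic : (B : BilSpace) → Subset (dim B) → Set
IsCoisotropic B S = ∀ u → (∀ v → v ∈ˢ S → form B u v ≡ false) → u ∈ˢ S

coisotropic⇒maximal : ∀ B {S} → IsTotallyIsotropic B S → IsCoisotropic B S → IsMaxTotallyIsotropic B S
coisotropic⇒maximal B {S} isotropic coisotropic = isotropic , maximal
  where
  maximal : ∀ S' → IsTotallyIsotropic B S' → S ⊆ˢ S' → S' ≡ S
  maximal S' (_ , isotropic') S⊆S' =
    Subset-ext (λ x x∈S' → coisotropic x λ v v∈S → isotropic' x v x∈S' (S⊆S' v v∈S)) S⊆S'

toSubset-maximal : ∀ B {L : Vector B → Set} (L? : Decidable L) → L 0ᵛ →
  (∀ u v → L u → L v → L (u ⊕ v)) →
  (∀ u v → L u → L v → form B u v ≡ false) →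
  (∀ u → (∀ v → L v → form B u v ≡ false) → L u) →
  IsMaxTotallyIsotropic B (toSubset L?)
toSubset-maximal B {L} L? 0∈ ⊕-closed isotropic coisotropic =
  coisotropic⇒maximal B ((from 0ᵛ 0∈ , ⊕-closed') , isotropic') coisotropic'
  where
  to   = λ x → ⇔-to (∈-toSubset L? x)
  from = λ x → ⇔-from (∈-toSubset L? x)
  ⊕-closed' : ∀ u v → u ∈ˢ toSubset L? → v ∈ˢ toSubset L? → (u ⊕ v) ∈ˢ toSubset L?
  ⊕-closed' u v u∈ v∈ = from (u ⊕ v) (⊕-closed u v (to u u∈) (to v v∈))
  isotropic' : ∀ u v → u ∈ˢ toSubset L? → v ∈ˢ toSubset L? → form B u v ≡ false
  isotropic' u v u∈ v∈ = isotropic u v (to u u∈) (to v v∈)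
  coisotropic' : IsCoisotropic B (toSubset L?)
  coisotropic' u u⊥ = from u (coisotropic u λ v v∈ → u⊥ v (from v v∈))

module _ (B : BilSpace)
  (form-sym : ∀ u v → form B u v ≡ form B v u)
  (form-linˡ : ∀ u v w → form B (u ⊕ v) w ≡ form B u w xor form B v w) where

  open SymmetricBilinear (form B) form-sym form-linˡ

  -- S is contained in the totally isotropic subspace S + 𝔽₂ u, hence equal to it.
  maximal-⊥-isotropic⇒∈ : ∀ {S} → IsMaxTotallyIsotropic B S → ∀ u → form B u u ≡ false →
                          (∀ v → v ∈ˢ S → form B u v ≡ false) → u ∈ˢ S
  maximal-⊥-isotropic⇒∈ {S} (((0∈S , ⊕-closed) , isotropic) , maximal) u uu u⊥S =
    subst (u ∈ˢ_) S+u≡S (⇔-from (∈-S+u u) (true , subst (_∈ˢ S) (sym (⊕-self u)) 0∈S))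
    where
    S+u : Subset (dim B)
    S+u = toSubset λ y → ∃-Bool? λ c → T? (member (y ⊕ c · u) S)

    ∈-S+u : ∀ y → y ∈ˢ S+u ⇔ Σ Bool λ c → (y ⊕ c · u) ∈ˢ S
    ∈-S+u = ∈-toSubset _

    S⊆S+u : S ⊆ˢ S+u
    S⊆S+u y y∈S = ⇔-from (∈-S+u y) (false , subst (_∈ˢ S) (sym (⊕-identityʳ y)) y∈S)

    ⊕-closed' : ∀ x y → x ∈ˢ S+u → y ∈ˢ S+u → (x ⊕ y) ∈ˢ S+u
    ⊕-closed' x y x∈ y∈ with ⇔-to (∈-S+u x) x∈ | ⇔-to (∈-S+u y) y∈
    ... | c , x' | c' , y' = ⇔-from (∈-S+u (x ⊕ y))
      (c xor c' , subst (_∈ˢ S) (sym (⊕-·-interchange x y c c' u)) (⊕-closed (x ⊕ c · u) (y ⊕ c' · u) x' y'))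

    isotropic' : ∀ x y → x ∈ˢ S+u → y ∈ˢ S+u → form B x y ≡ false
    isotropic' x y x∈ y∈ with ⇔-to (∈-S+u x) x∈ | ⇔-to (∈-S+u y) y∈
    ... | c , x' | c' , y' = begin
      form B x y
        ≡⟨ sym (cong₂ (form B) (⊕-cancelʳ x (c · u)) (⊕-cancelʳ y (c' · u))) ⟩
      form B ((x ⊕ c · u) ⊕ c · u) ((y ⊕ c' · u) ⊕ c' · u)
        ≡⟨ β-shift uu (x ⊕ c · u) (y ⊕ c' · u) c c' ⟩
      (form B (x ⊕ c · u) (y ⊕ c' · u) xor (c' ∧ form B u (x ⊕ c · u))) xor (c ∧ form B u (y ⊕ c' · u))
        ≡⟨ cong₂ (λ p q → (p xor (c' ∧ q)) xor (c ∧ form B u (y ⊕ c' · u)))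
                 (isotropic (x ⊕ c · u) (y ⊕ c' · u) x' y') (u⊥S (x ⊕ c · u) x') ⟩
      (false xor (c' ∧ false)) xor (c ∧ form B u (y ⊕ c' · u))
        ≡⟨ cong (λ q → (false xor (c' ∧ false)) xor (c ∧ q)) (u⊥S (y ⊕ c' · u) y') ⟩
      (false xor (c' ∧ false)) xor (c ∧ false)
        ≡⟨ vanish c c' ⟩
      false ∎
      where
      open xor-∧-Solver
      open ≡-Reasoning
      vanish : ∀ c c' → (false xor (c' ∧ false)) xor (c ∧ false) ≡ false
      vanish = solve 2 (λ c c' → (con false :+ (c' :* con false)) :+ (c :* con false) := con false) refl

    S+u≡S : S+u ≡ S
    S+u≡S = maximal S+u ((S⊆S+u 0ᵛ 0∈S , ⊕-closed') , isotropic') S⊆S+u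

bools : List Bool
bools = true ∷ false ∷ []

bools-unique : Unique bools
bools-unique = ((λ ()) All.∷ All.[]) ∷ All.[] ∷ []

∈-bools : ∀ b → b ∈ bools
∈-bools true  = here refl
∈-bools false = there (here refl)

length-cartesianProductWith : ∀ {A B C : Set} (f : A → B → C) xs ys →
  length (cartesianProductWith f xs ys) ≡ length xs ℕ.* length ys
length-cartesianProductWith f []       ys = refl
length-cartesianProductWith f (x ∷ xs) ys =
  trans (length-++ (map (f x) ys)) (cong₂ _+_ (length-map (f x) ys) (length-cartesianProductWith f xs ys))

allVec : ∀ n → List (Vec Bool n)
allVec zero    = [] ∷ []
allVec (suc n) = cartesianProductWith _∷_ bools (allVec n)

allVec-unique : ∀ n → Unique (allVec n)
allVec-unique zero    = All.[] ∷ []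
allVec-unique (suc n) = Unique.cartesianProductWith⁺ _∷_ ∷-injective bools-unique (allVec-unique n)

∈-allVec : ∀ {n} (v : Vec Bool n) → v ∈ allVec n
∈-allVec []      = here refl
∈-allVec (x ∷ v) = ∈-cartesianProductWith⁺ _∷_ (∈-bools x) (∈-allVec v)

length-allVec : ∀ n → length (allVec n) ≡ 2 ^ n
length-allVec zero    = refl
length-allVec (suc n) = trans (length-cartesianProductWith _∷_ bools (allVec n)) (cong (2 ℕ.*_) (length-allVec n))

search : ∀ {n} {P : Vec Bool n → Set} → Decidable P → Σ (Vec Bool n) P ⊎ (∀ v → ¬ P v)
search P? with any? P? (allVec _)
... | yes found = inj₁ (satisfied found)
... | no  none  = inj₂ λ v Pv → none (lose (∈-allVec v) Pv)

-- Lagrangians of 𝐇^t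

record IsLagrangian (t : ℕ) (L : V t → Set) : Set where
  field
    0∈          : L 0ᵛ
    ⊕-closed    : ∀ u v → L u → L v → L (u ⊕ v)
    isotropic   : ∀ u v → L u → L v → ω t u v ≡ false
    coisotropic : ∀ u → (∀ v → L v → ω t u v ≡ false) → L u

lagrangian⇒maximal : ∀ t {L} → IsLagrangian t L → (L? : Decidable L) → IsMaxTotallyIsotropic (𝐇 ^⊞ t) (toSubset L?)
lagrangian⇒maximal t lag L? = toSubset-maximal (𝐇 ^⊞ t) L? 0∈ ⊕-closed
  (λ u v u∈ v∈ → trans (form-𝐇^⊞ t u v) (isotropic u v u∈ v∈))
  (λ u u⊥ → coisotropic u λ v v∈ → trans (sym (form-𝐇^⊞ t u v)) (u⊥ v v∈))
  where open IsLagrangian lag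

maximal⇒lagrangian : ∀ t {S} → IsMaxTotallyIsotropic (𝐇 ^⊞ t) S → IsLagrangian t (_∈ˢ S)
maximal⇒lagrangian t {S} maximal@(((0∈S , ⊕-closedS) , isotropicS) , _) = record
  { 0∈          = 0∈S
  ; ⊕-closed    = ⊕-closedS
  ; isotropic   = λ u v u∈ v∈ → trans (sym (form-𝐇^⊞ t u v)) (isotropicS u v u∈ v∈)
  ; coisotropic = λ u u⊥ → maximal-⊥-isotropic⇒∈ (𝐇 ^⊞ t) form-sym form-linˡ maximal u
                             (trans (form-𝐇^⊞ t u u) (ω-self t u))
                             (λ v v∈ → trans (form-𝐇^⊞ t u v) (u⊥ v v∈))
  }
  where
  open ≡-Reasoning
  form-sym : ∀ u v → form (𝐇 ^⊞ t) u v ≡ form (𝐇 ^⊞ t) v u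
  form-sym u v = begin
    form (𝐇 ^⊞ t) u v ≡⟨ form-𝐇^⊞ t u v ⟩
    ω t u v           ≡⟨ ω-sym t u v ⟩
    ω t v u           ≡⟨ form-𝐇^⊞ t v u ⟨
    form (𝐇 ^⊞ t) v u ∎
  form-linˡ : ∀ u v w → form (𝐇 ^⊞ t) (u ⊕ v) w ≡ form (𝐇 ^⊞ t) u w xor form (𝐇 ^⊞ t) v w
  form-linˡ u v w = begin
    form (𝐇 ^⊞ t) (u ⊕ v) w                   ≡⟨ form-𝐇^⊞ t (u ⊕ v) w ⟩
    ω t (u ⊕ v) w                             ≡⟨ ω-linˡ t u v w ⟩
    ω t u w xor ω t v w                       ≡⟨ cong₂ _xor_ (form-𝐇^⊞ t u w) (form-𝐇^⊞ t v w) ⟨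
    form (𝐇 ^⊞ t) u w xor form (𝐇 ^⊞ t) v w   ∎

lagrangian-⊆ : ∀ {t L P} → IsLagrangian t L → IsLagrangian t P → (∀ v → P v → L v) → ∀ v → L v → P v
lagrangian-⊆ L-lag P-lag P⊆L v v∈L = IsLagrangian.coisotropic P-lag v λ w w∈P →
  IsLagrangian.isotropic L-lag v w v∈L (P⊆L w w∈P)

∈-or-pairs-nontrivially : ∀ {t L} → IsLagrangian t L → Decidable L →
                          ∀ u → L u ⊎ Σ (V t) λ w → L w × ω t u w ≡ true
∈-or-pairs-nontrivially {t} lag L? u with search (λ w → L? w ×-dec (ω t u w ≟ true))
... | inj₁ found = inj₂ found
... | inj₂ none  = inj₁ (IsLagrangian.coisotropic lag u λ v v∈L → ¬-not λ ω≡true → none v (v∈L , ω≡true))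

xor≡false⇒≡ : ∀ {x y} → x xor y ≡ false → x ≡ y
xor≡false⇒≡ {false} {false} _ = refl
xor≡false⇒≡ {true}  {true}  _ = refl

ω-∷-false : ∀ t x x' u v → ω (suc t) (x ∷ false ∷ u) (x' ∷ false ∷ v) ≡ ω t u v
ω-∷-false t x x' u v = drop-line x (ω t u v)
  where
  open xor-∧-Solver
  drop-line : ∀ x p → ((x ∧ false) xor false) xor p ≡ p
  drop-line = solve 2 (λ x p → ((x :* con false) :+ con false) :+ p := p) refl

ω-∷-0 : ∀ t x y u v → ω (suc t) (x ∷ y ∷ u) (false ∷ false ∷ v) ≡ ω t u v
ω-∷-0 t x y u v = drop-line x y (ω t u v)
  where
  open xor-∧-Solver
  drop-line : ∀ x y p → ((x ∧ false) xor (y ∧ false)) xor p ≡ p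
  drop-line = solve 3 (λ x y p → ((x :* con false) :+ (y :* con false)) :+ p := p) refl

ω-e : ∀ t x y v → ω (suc t) (true ∷ false ∷ 0ᵛ) (x ∷ y ∷ v) ≡ y
ω-e t x y v rewrite Ω.β-zeroˡ t v = trans (xor-identityʳ (y xor false)) (xor-identityʳ y)

ω-∷-f : ∀ t x x' u v → ω (suc t) (x ∷ false ∷ u) (x' ∷ true ∷ v) ≡ x xor ω t u v
ω-∷-f t x x' u v = pick-x x (ω t u v)
  where
  open xor-∧-Solver
  pick-x : ∀ x p → ((x ∧ true) xor false) xor p ≡ x xor p
  pick-x = solve 2 (λ x p → ((x :* con true) :+ con false) :+ p := x :+ p) refl

-- With e = (1,0) and f = (0,1) the basis of 𝐇, a Lagrangian L of 𝐇 ⊞ W is determined by the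
-- Lagrangian Q = {v | ∃ x. x e + v ∈ L} of W together with `nothing` if e ∈ L, and otherwise
-- with (a , z) such that a e + f + n ∈ L, where n = complement z is the chosen representative
-- of the class of W / Q in which L meets f + W.
Desc : ℕ → Set
Desc zero    = ⊤
Desc (suc t) = Maybe (Bool × Vec Bool t) × Desc t

complement : ∀ t → Desc t → Vec Bool t → V t
complement zero    _             []       = []
complement (suc t) (nothing , d) (z ∷ zs) = false ∷ z ∷ complement t d zs
complement (suc t) (just _  , d) (z ∷ zs) = z ∷ false ∷ complement t d zs

Described : ∀ t → Desc t → V t → Set
Described zero    _                  []          = ⊤
Described (suc t) (nothing , d)      (x ∷ y ∷ v) = y ≡ false × Described t d v
Described (suc t) (just (a , z) , d) (x ∷ y ∷ v) =
  Described t d (v ⊕ y · complement t d z) × x ≡ (y ∧ a) xor ω t (complement t d z) v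

described? : ∀ t d → Decidable (Described t d)
described? zero    _                  []          = yes _
described? (suc t) (nothing , d)      (x ∷ y ∷ v) = (y ≟ false) ×-dec described? t d v
described? (suc t) (just (a , z) , d) (x ∷ y ∷ v) =
  described? t d (v ⊕ y · complement t d z) ×-dec (x ≟ (y ∧ a) xor ω t (complement t d z) v)

described-0 : ∀ t d → Described t d 0ᵛ
described-0 zero    _                  = _
described-0 (suc t) (nothing , d)      = refl , described-0 t d
described-0 (suc t) (just (a , z) , d) =
  subst (Described t d) (sym (⊕-identityʳ 0ᵛ)) (described-0 t d) , sym (Ω.β-zeroʳ t (complement t d z))

described-base : ∀ t d a z → Described (suc t) (just (a , z) , d) (a ∷ true ∷ complement t d z)
described-base t d a z =
  subst (Described t d) (sym (⊕-self n)) (described-0 t d) ,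
  sym (trans (cong (a xor_) (ω-self t n)) (xor-identityʳ a))
  where n = complement t d z

described-⊕ : ∀ t d u v → Described t d u → Described t d v → Described t d (u ⊕ v)
described-⊕ zero    _                  []          []            _          _          = _
described-⊕ (suc t) (nothing , d)      (x ∷ y ∷ u) (x' ∷ y' ∷ v) (refl , u∈) (refl , v∈) =
  refl , described-⊕ t d u v u∈ v∈
described-⊕ (suc t) (just (a , z) , d) (x ∷ y ∷ u) (x' ∷ y' ∷ v) (u∈ , refl) (v∈ , refl) =
  subst (Described t d) (sym (⊕-·-interchange u v y y' n)) (described-⊕ t d (u ⊕ y · n) (v ⊕ y' · n) u∈ v∈) ,
  (begin
    ((y ∧ a) xor ω t n u) xor ((y' ∧ a) xor ω t n v)  ≡⟨ collect y y' a (ω t n u) (ω t n v) ⟩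
    ((y xor y') ∧ a) xor (ω t n u xor ω t n v)        ≡⟨ cong (((y xor y') ∧ a) xor_) (Ω.β-linʳ t n u v) ⟨
    ((y xor y') ∧ a) xor ω t n (u ⊕ v)                ∎)
  where
  open xor-∧-Solver
  open ≡-Reasoning
  n = complement t d z
  collect : ∀ y y' a p q → ((y ∧ a) xor p) xor ((y' ∧ a) xor q) ≡ ((y xor y') ∧ a) xor (p xor q)
  collect = solve 5 (λ y y' a p q → ((y :* a) :+ p) :+ ((y' :* a) :+ q) := ((y :+ y') :* a) :+ (p :+ q)) refl

described-isotropic : ∀ t d u v → Described t d u → Described t d v → ω t u v ≡ false
described-isotropic zero    _                  []          []            _          _          = refl
described-isotropic (suc t) (nothing , d)      (x ∷ y ∷ u) (x' ∷ y' ∷ v) (refl , u∈) (refl , v∈) =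
  trans (ω-∷-false t x x' u v) (described-isotropic t d u v u∈ v∈)
described-isotropic (suc t) (just (a , z) , d) (x ∷ y ∷ u) (x' ∷ y' ∷ v) (u∈ , refl) (v∈ , refl) = begin
  ((((y ∧ a) xor ω t n u) ∧ y') xor (y ∧ ((y' ∧ a) xor ω t n v))) xor ω t u v
    ≡⟨ cancel y y' a (ω t n u) (ω t n v) (ω t u v) ⟩
  (ω t u v xor (y' ∧ ω t n u)) xor (y ∧ ω t n v)
    ≡⟨ Ω.β-shift t (ω-self t n) u v y y' ⟨
  ω t (u ⊕ y · n) (v ⊕ y' · n)
    ≡⟨ described-isotropic t d (u ⊕ y · n) (v ⊕ y' · n) u∈ v∈ ⟩
  false ∎
  where
  open xor-∧-Solver
  open ≡-Reasoning
  n = complement t d z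
  cancel : ∀ y y' a p q r →
    ((((y ∧ a) xor p) ∧ y') xor (y ∧ ((y' ∧ a) xor q))) xor r ≡ (r xor (y' ∧ p)) xor (y ∧ q)
  cancel = solve 6 (λ y y' a p q r →
      ((((y :* a) :+ p) :* y') :+ (y :* ((y' :* a) :+ q))) :+ r :=
      (r :+ (y' :* p)) :+ (y :* q)) refl

described-coisotropic : ∀ t d u → (∀ v → Described t d v → ω t u v ≡ false) → Described t d u
described-coisotropic zero    _                  []          _  = _
described-coisotropic (suc t) (nothing , d)      (x ∷ y ∷ v) u⊥ =
  trans (sym (ω-e t x y v)) (trans (ω-sym (suc t) e (x ∷ y ∷ v)) (u⊥ e (refl , described-0 t d))) ,
  described-coisotropic t d v λ m m∈ → trans (sym (ω-∷-0 t x y v m)) (u⊥ (false ∷ false ∷ m) (refl , m∈))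
  where
  e : V (suc t)
  e = true ∷ false ∷ 0ᵛ
described-coisotropic (suc t) (just (a , z) , d) (x ∷ y ∷ v) u⊥ =
  described-coisotropic t d (v ⊕ y · n) v⊥ ,
  (begin
    x                                  ≡⟨ xor≡false⇒≡ (trans (sym (pick-x x y a (ω t v n))) (u⊥ (a ∷ true ∷ n) (described-base t d a z))) ⟩
    (y ∧ a) xor ω t v n                ≡⟨ cong ((y ∧ a) xor_) (ω-sym t v n) ⟩
    (y ∧ a) xor ω t n v                ∎)
  where
  open xor-∧-Solver
  open ≡-Reasoning
  n = complement t d z
  pick-x : ∀ x y a r → ((x ∧ true) xor (y ∧ a)) xor r ≡ x xor ((y ∧ a) xor r)
  pick-x = solve 4 (λ x y a r → ((x :* con true) :+ (y :* a)) :+ r := x :+ ((y :* a) :+ r)) refl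
  pick-y : ∀ x y q p → ((x ∧ false) xor (y ∧ q)) xor p ≡ p xor (y ∧ q)
  pick-y = solve 4 (λ x y q p → ((x :* con false) :+ (y :* q)) :+ p := p :+ (y :* q)) refl
  v⊥ : ∀ m → Described t d m → ω t (v ⊕ y · n) m ≡ false
  v⊥ m m∈ = begin
    ω t (v ⊕ y · n) m                             ≡⟨ ω-linˡ t v (y · n) m ⟩
    ω t v m xor ω t (y · n) m                     ≡⟨ cong (ω t v m xor_) (Ω.β-·ˡ t y n m) ⟩
    ω t v m xor (y ∧ ω t n m)                     ≡⟨ pick-y x y (ω t n m) (ω t v m) ⟨
    ((x ∧ false) xor (y ∧ ω t n m)) xor ω t v m   ≡⟨ u⊥ (ω t n m ∷ false ∷ m) (subst (Described t d) (sym (⊕-identityʳ m)) m∈ , refl) ⟩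
    false                                         ∎

described-lagrangian : ∀ t d → IsLagrangian t (Described t d)
described-lagrangian t d = record
  { 0∈          = described-0 t d
  ; ⊕-closed    = described-⊕ t d
  ; isotropic   = described-isotropic t d
  ; coisotropic = described-coisotropic t d
  }

complement-represents : ∀ t d v → Σ (Vec Bool t) λ zs → Described t d (complement t d zs ⊕ v)
complement-represents zero    _                  []          = [] , _
complement-represents (suc t) (nothing , d)      (x ∷ y ∷ v) =
  let zs , c⊕v∈ = complement-represents t d v in (y ∷ zs) , xor-same y , c⊕v∈
complement-represents (suc t) (just (a , z) , d) (x ∷ y ∷ v) =
  let zs , c⊕v∈ = complement-represents t d (v ⊕ y · n)
      c = complement t d zs
  in ((x xor ((y ∧ a) xor ω t n (c ⊕ v))) ∷ zs) ,
     subst (Described t d) (sym (⊕-assoc c v (y · n))) c⊕v∈ ,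
     cancel x ((y ∧ a) xor ω t n (c ⊕ v))
  where
  open xor-∧-Solver
  n = complement t d z
  cancel : ∀ x r → (x xor r) xor x ≡ r
  cancel = solve 2 (λ x r → (x :+ r) :+ x := r) refl

complement-injective : ∀ t d zs zs' → Described t d (complement t d zs ⊕ complement t d zs') → zs ≡ zs'
complement-injective zero    _                  []       []         _          = refl
complement-injective (suc t) (nothing , d)      (z ∷ zs) (z' ∷ zs') (z≐z' , h) =
  cong₂ _∷_ (xor≡false⇒≡ z≐z') (complement-injective t d zs zs' h)
complement-injective (suc t) (just (a , _) , d) (z ∷ zs) (z' ∷ zs') (h , z≐z')
  with complement-injective t d zs zs' (subst (Described t d) (⊕-identityʳ _) h)
... | refl = cong (_∷ zs) (xor≡false⇒≡ (trans z≐z' (trans (cong (ω t _) (⊕-self _)) (Ω.β-zeroʳ t _))))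

project : ∀ t → (V (suc t) → Set) → V t → Set
project t P v = Σ Bool λ x → P (x ∷ false ∷ v)

project-mono : ∀ t {P P' : V (suc t) → Set} → (∀ w → P w → P' w) → ∀ v → project t P v → project t P' v
project-mono t P⊆P' v (x , w∈) = x , P⊆P' (x ∷ false ∷ v) w∈

project-described : ∀ t o d v → project t (Described (suc t) (o , d)) v ⇔ Described t d v
project-described t nothing      d v = mk⇔ (λ { (_ , refl , v∈) → v∈ }) (λ v∈ → false , refl , v∈)
project-described t (just (a , z)) d v = mk⇔
  (λ { (_ , v∈ , _) → subst (Described t d) (⊕-identityʳ v) v∈ })
  (λ v∈ → ω t (complement t d z) v , subst (Described t d) (sym (⊕-identityʳ v)) v∈ , refl)

option-injective : ∀ t d o o' → (∀ w → Described (suc t) (o , d) w → Described (suc t) (o' , d) w) → o ≡ o'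
option-injective t d nothing       nothing       _ = refl
option-injective t d nothing       (just (a , z)) ⊆ with trans (proj₂ (⊆ (true ∷ false ∷ 0ᵛ) (refl , described-0 t d)))
                                                          (Ω.β-zeroʳ t (complement t d z))
... | ()
option-injective t d (just (a , z)) nothing       ⊆ with proj₁ (⊆ (a ∷ true ∷ complement t d z) (described-base t d a z))
... | ()
option-injective t d (just (a , z)) (just (a' , z')) ⊆ with ⊆ (a ∷ true ∷ complement t d z) (described-base t d a z)
... | n⊕n'∈ , a≡ with complement-injective t d z z' n⊕n'∈
... | refl = cong (λ a → just (a , z))
  (trans a≡ (trans (cong (a' xor_) (ω-self t (complement t d z))) (xor-identityʳ a')))

described-injective : ∀ t d d' → (∀ v → Described t d v → Described t d' v) → d ≡ d'
described-injective zero    _       _         _ = refl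
described-injective (suc t) (o , d) (o' , d') ⊆ with described-injective t d d' d⊆d'
  where
  d⊆d' : ∀ v → Described t d v → Described t d' v
  d⊆d' v v∈ = ⇔-to (project-described t o' d' v) (project-mono t ⊆ v (⇔-from (project-described t o d v) v∈))
... | refl = cong (_, d) (option-injective t d o o' ⊆)

module Projection {t} {P : V (suc t) → Set} (P-lag : IsLagrangian (suc t) P) (P? : Decidable P) where
  open IsLagrangian P-lag

  e : V (suc t)
  e = true ∷ false ∷ 0ᵛ

  project? : Decidable (project t P)
  project? v = ∃-Bool? λ x → P? (x ∷ false ∷ v)

  e∈-or-f-line : P e ⊎ Σ Bool λ x₀ → Σ (V t) λ v₀ → P (x₀ ∷ true ∷ v₀)
  e∈-or-f-line with ∈-or-pairs-nontrivially P-lag P? e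
  ... | inj₁ e∈P = inj₁ e∈P
  ... | inj₂ ((x₀ ∷ y₀ ∷ v₀) , w₀∈P , ω≡true) with trans (sym (ω-e t x₀ y₀ v₀)) ω≡true
  ... | refl = inj₂ (x₀ , v₀ , w₀∈P)

  e∈⇒f-coordinate≡0 : P e → ∀ x y v → P (x ∷ y ∷ v) → y ≡ false
  e∈⇒f-coordinate≡0 e∈P x y v w∈P = trans (sym (ω-e t x y v)) (isotropic e (x ∷ y ∷ v) e∈P w∈P)

  project-coisotropic : ∀ u → (∀ v → project t P v → ω t u v ≡ false) → project t P u
  project-coisotropic u u⊥ with e∈-or-f-line
  ... | inj₁ e∈P = false , coisotropic (false ∷ false ∷ u) ⊥P
    where
    ⊥P : ∀ w → P w → ω (suc t) (false ∷ false ∷ u) w ≡ false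
    ⊥P (x ∷ y ∷ v) w∈P with e∈⇒f-coordinate≡0 e∈P x y v w∈P
    ... | refl = trans (ω-∷-false t false x u v) (u⊥ v (x , w∈P))
  ... | inj₂ (x₀ , v₀ , w₀∈P) = ω t u v₀ , coisotropic (ω t u v₀ ∷ false ∷ u) ⊥P
    where
    ⊥P : ∀ w → P w → ω (suc t) (ω t u v₀ ∷ false ∷ u) w ≡ false
    ⊥P (x ∷ false ∷ v) w∈P = trans (ω-∷-false t (ω t u v₀) x u v) (u⊥ v (x , w∈P))
    ⊥P (x ∷ true  ∷ v) w∈P = begin
      ω (suc t) (ω t u v₀ ∷ false ∷ u) (x ∷ true ∷ v) ≡⟨ ω-∷-f t (ω t u v₀) x u v ⟩
      ω t u v₀ xor ω t u v                          ≡⟨ Ω.β-linʳ t u v₀ v ⟨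
      ω t u (v₀ ⊕ v)                                ≡⟨ u⊥ (v₀ ⊕ v) (x₀ xor x , ⊕-closed _ _ w₀∈P w∈P) ⟩
      false                                         ∎
      where open ≡-Reasoning

  project-lagrangian : IsLagrangian t (project t P)
  project-lagrangian = record
    { 0∈          = false , 0∈
    ; ⊕-closed    = λ { u v (x , u∈) (x' , v∈) → x xor x' , ⊕-closed _ _ u∈ v∈ }
    ; isotropic   = λ { u v (x , u∈) (x' , v∈) → trans (sym (ω-∷-false t x x' u v)) (isotropic _ _ u∈ v∈) }
    ; coisotropic = project-coisotropic
    }

  extend : ∀ {d} → (∀ v → project t P v ⇔ Described t d v) →
           Σ (Desc (suc t)) λ D → ∀ w → P w → Described (suc t) D w
  extend {d} Q⇔ with e∈-or-f-line
  ... | inj₁ e∈P = (nothing , d) , P⊆D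
    where
    P⊆D : ∀ w → P w → Described (suc t) (nothing , d) w
    P⊆D (x ∷ y ∷ v) w∈P with e∈⇒f-coordinate≡0 e∈P x y v w∈P
    ... | refl = refl , ⇔-to (Q⇔ v) (x , w∈P)
  ... | inj₂ (x₀ , v₀ , w₀∈P) = (just (a , zs) , d) , P⊆D
    where
    open ≡-Reasoning
    zs = proj₁ (complement-represents t d v₀)
    n  = complement t d zs
    n⊕v₀∈Q : project t P (n ⊕ v₀)
    n⊕v₀∈Q = ⇔-from (Q⇔ (n ⊕ v₀)) (proj₂ (complement-represents t d v₀))
    a  = x₀ xor ω t n v₀

    -- The e-coordinate of a point of L on W is forced by isotropy against a point on f + W.
    e-coordinate : ∀ x v → P (x ∷ false ∷ v) → x ≡ ω t n v
    e-coordinate x v w∈P = begin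
      x           ≡⟨ xor≡false⇒≡ (trans (sym (ω-∷-f t x x₀ v v₀)) (isotropic _ _ w∈P w₀∈P)) ⟩
      ω t v v₀    ≡⟨ xor≡false⇒≡ (trans (sym (Ω.β-linʳ t v n v₀))
                                   (IsLagrangian.isotropic project-lagrangian v (n ⊕ v₀) (x , w∈P) n⊕v₀∈Q)) ⟨
      ω t v n     ≡⟨ ω-sym t v n ⟩
      ω t n v     ∎

    P⊆D : ∀ w → P w → Described (suc t) (just (a , zs) , d) w
    P⊆D (x ∷ false ∷ v) w∈P =
      subst (Described t d) (sym (⊕-identityʳ v)) (⇔-to (Q⇔ v) (x , w∈P)) , e-coordinate x v w∈P
    P⊆D (x ∷ true ∷ v) w∈P =
      subst (Described t d) (⊕-cancel v n v₀)
        (described-⊕ t d _ _ (⇔-to (Q⇔ (v ⊕ v₀)) (x xor x₀ , w⊕w₀∈P)) (⇔-to (Q⇔ _) n⊕v₀∈Q)) ,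
      (begin
        x                                      ≡⟨ solve-x x x₀ ⟩
        (x xor x₀) xor x₀                      ≡⟨ cong (_xor x₀) (e-coordinate (x xor x₀) (v ⊕ v₀) w⊕w₀∈P) ⟩
        ω t n (v ⊕ v₀) xor x₀                  ≡⟨ cong (_xor x₀) (Ω.β-linʳ t n v v₀) ⟩
        (ω t n v xor ω t n v₀) xor x₀          ≡⟨ regroup (ω t n v) (ω t n v₀) x₀ ⟩
        (x₀ xor ω t n v₀) xor ω t n v          ∎)
      where
      open xor-∧-Solver
      w⊕w₀∈P : P ((x xor x₀) ∷ false ∷ (v ⊕ v₀))
      w⊕w₀∈P = ⊕-closed _ _ w∈P w₀∈P
      solve-x : ∀ x x₀ → x ≡ (x xor x₀) xor x₀
      solve-x = solve 2 (λ x x₀ → x := (x :+ x₀) :+ x₀) refl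
      regroup : ∀ p q x₀ → (p xor q) xor x₀ ≡ (x₀ xor q) xor p
      regroup = solve 3 (λ p q x₀ → (p :+ q) :+ x₀ := (x₀ :+ q) :+ p) refl

describe : ∀ t {P} → IsLagrangian t P → Decidable P → Σ (Desc t) λ d → ∀ v → P v ⇔ Described t d v
describe zero    P-lag P? = _ , λ { [] → mk⇔ (λ _ → _) (λ _ → IsLagrangian.0∈ P-lag) }
describe (suc t) P-lag P? =
  let D , P⊆D = extend (proj₂ (describe t project-lagrangian project?))
  in D , λ w → mk⇔ (P⊆D w) (lagrangian-⊆ (described-lagrangian (suc t) D) P-lag P⊆D w)
  where open Projection P-lag P?

-- Counting

options : ∀ t → List (Maybe (Bool × Vec Bool t))
options t = nothing ∷ map just (cartesianProduct bools (allVec t))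

options-unique : ∀ t → Unique (options t)
options-unique t =
  All.map⁺ (All.tabulate λ _ ()) ∷ Unique.map⁺ just-injective (Unique.cartesianProduct⁺ bools-unique (allVec-unique t))

∈-options : ∀ t o → o ∈ options t
∈-options t nothing        = here refl
∈-options t (just (a , z)) = there (∈-map⁺ just (∈-cartesianProduct⁺ (∈-bools a) (∈-allVec z)))

length-options : ∀ t → length (options t) ≡ suc (2 ^ suc t)
length-options t = cong suc (begin
  length (map just (cartesianProduct bools (allVec t))) ≡⟨ length-map just (cartesianProduct bools (allVec t)) ⟩
  length (cartesianProduct bools (allVec t))            ≡⟨ length-cartesianProductWith _,_ bools (allVec t) ⟩
  2 ℕ.* length (allVec t)                               ≡⟨ cong (2 ℕ.*_) (length-allVec t) ⟩
  2 ^ suc t                                             ∎)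
  where open ≡-Reasoning

allDesc : ∀ t → List (Desc t)
allDesc zero    = tt ∷ []
allDesc (suc t) = cartesianProduct (options t) (allDesc t)

allDesc-unique : ∀ t → Unique (allDesc t)
allDesc-unique zero    = All.[] ∷ []
allDesc-unique (suc t) = Unique.cartesianProduct⁺ (options-unique t) (allDesc-unique t)

∈-allDesc : ∀ t d → d ∈ allDesc t
∈-allDesc zero    tt      = here refl
∈-allDesc (suc t) (o , d) = ∈-cartesianProduct⁺ (∈-options t o) (∈-allDesc t d)

lagrangianCount : ℕ → ℕ
lagrangianCount zero    = 1
lagrangianCount (suc t) = suc (2 ^ suc t) ℕ.* lagrangianCount t

length-allDesc : ∀ t → length (allDesc t) ≡ lagrangianCount t
length-allDesc zero    = refl
length-allDesc (suc t) = trans (length-cartesianProductWith _,_ (options t) (allDesc t))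
                               (cong₂ ℕ._*_ (length-options t) (length-allDesc t))

count-by-descriptions : ∀ {n} {D : Set} (P : Subset n → Set) (Mem : D → Vec Bool n → Set)
  (Mem? : ∀ d → Decidable (Mem d)) (ds : List D) → Unique ds → (∀ d → d ∈ ds) →
  (∀ d d' → (∀ v → Mem d v → Mem d' v) → d ≡ d') →
  (∀ d → P (toSubset (Mem? d))) →
  (∀ S → P S → Σ D λ d → S ≡ toSubset (Mem? d)) →
  HasCount P (length ds)
count-by-descriptions P Mem Mem? ds unique complete injective sound exhaustive =
  map subset ds , Unique.map⁺ subset-injective unique , (λ S → mk⇔ (listed⇒P S) (P⇒listed S)) , length-map subset ds
  where
  subset = λ d → toSubset (Mem? d)
  subset-injective : ∀ {d d'} → subset d ≡ subset d' → d ≡ d'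
  subset-injective {d} {d'} eq = injective d d' λ v v∈ →
    ⇔-to (∈-toSubset (Mem? d') v) (subst (v ∈ˢ_) eq (⇔-from (∈-toSubset (Mem? d) v) v∈))
  listed⇒P : ∀ S → S ∈ map subset ds → P S
  listed⇒P S S∈ with ∈-map⁻ subset S∈
  ... | d , _ , refl = sound d
  P⇒listed : ∀ S → P S → S ∈ map subset ds
  P⇒listed S PS with exhaustive S PS
  ... | d , refl = ∈-map⁺ subset (complete d)

count-𝐇^⊞ : ∀ t → HasCount (IsMaxTotallyIsotropic (𝐇 ^⊞ t)) (lagrangianCount t)
count-𝐇^⊞ t = subst (HasCount _) (length-allDesc t)
  (count-by-descriptions _ (Described t) (described? t) (allDesc t) (allDesc-unique t) (∈-allDesc t)
    (described-injective t)
    (λ d → lagrangian⇒maximal t (described-lagrangian t d) (described? t d))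
    (λ S maximal → let d , S⇔d = describe t (maximal⇒lagrangian t maximal) (λ v → T? (member v S))
                   in d , ≡-toSubset (described? t d) (λ v → ⇔-to (S⇔d v)) (λ v → ⇔-from (S⇔d v))))

-- The space 𝐈 ⊞ 𝐈 ⊞ 𝐇^t

𝐈²⊞𝐇^ : ℕ → BilSpace
𝐈²⊞𝐇^ t = (𝐈 ⊞ 𝐈) ⊞ (𝐇 ^⊞ t)

form-𝐈 : ∀ p p' → form 𝐈 (p ∷ []) (p' ∷ []) ≡ p ∧ p'
form-𝐈 p p' = xor-identityʳ (p ∧ p')

form-𝐈²⊞𝐇^ : ∀ t p q v p' q' v' →
  form (𝐈²⊞𝐇^ t) (p ∷ q ∷ v) (p' ∷ q' ∷ v') ≡ ((p ∧ p') xor (q ∧ q')) xor ω t v v'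
form-𝐈²⊞𝐇^ t p q v p' q' v' =
  trans (form-⊞ (𝐈 ⊞ 𝐈) (𝐇 ^⊞ t) (p ∷ q ∷ []) (p' ∷ q' ∷ []) v v')
        (cong₂ _xor_ (trans (form-⊞ 𝐈 𝐈 (p ∷ []) (p' ∷ []) (q ∷ []) (q' ∷ []))
                            (cong₂ _xor_ (form-𝐈 p p') (form-𝐈 q q')))
                     (form-𝐇^⊞ t v v'))

form-𝐈²⊞𝐇^-sym : ∀ t u v → form (𝐈²⊞𝐇^ t) u v ≡ form (𝐈²⊞𝐇^ t) v u
form-𝐈²⊞𝐇^-sym t (p ∷ q ∷ u) (p' ∷ q' ∷ v) = begin
  form (𝐈²⊞𝐇^ t) (p ∷ q ∷ u) (p' ∷ q' ∷ v)   ≡⟨ form-𝐈²⊞𝐇^ t p q u p' q' v ⟩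
  ((p ∧ p') xor (q ∧ q')) xor ω t u v         ≡⟨ cong₂ _xor_ (swap p q p' q') (ω-sym t u v) ⟩
  ((p' ∧ p) xor (q' ∧ q)) xor ω t v u         ≡⟨ form-𝐈²⊞𝐇^ t p' q' v p q u ⟨
  form (𝐈²⊞𝐇^ t) (p' ∷ q' ∷ v) (p ∷ q ∷ u)   ∎
  where
  open xor-∧-Solver
  open ≡-Reasoning
  swap : ∀ p q p' q' → (p ∧ p') xor (q ∧ q') ≡ (p' ∧ p) xor (q' ∧ q)
  swap = solve 4 (λ p q p' q' → (p :* p') :+ (q :* q') := (p' :* p) :+ (q' :* q)) refl

form-𝐈²⊞𝐇^-linˡ : ∀ t u v w → form (𝐈²⊞𝐇^ t) (u ⊕ v) w ≡ form (𝐈²⊞𝐇^ t) u w xor form (𝐈²⊞𝐇^ t) v w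
form-𝐈²⊞𝐇^-linˡ t (p ∷ q ∷ u) (p' ∷ q' ∷ v) (p'' ∷ q'' ∷ w) = begin
  form (𝐈²⊞𝐇^ t) ((p xor p') ∷ (q xor q') ∷ (u ⊕ v)) (p'' ∷ q'' ∷ w)
    ≡⟨ form-𝐈²⊞𝐇^ t (p xor p') (q xor q') (u ⊕ v) p'' q'' w ⟩
  ((((p xor p') ∧ p'') xor ((q xor q') ∧ q''))) xor ω t (u ⊕ v) w
    ≡⟨ cong (((((p xor p') ∧ p'') xor ((q xor q') ∧ q''))) xor_) (ω-linˡ t u v w) ⟩
  ((((p xor p') ∧ p'') xor ((q xor q') ∧ q''))) xor (ω t u w xor ω t v w)
    ≡⟨ lin p q p' q' p'' q'' (ω t u w) (ω t v w) ⟩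
  (((p ∧ p'') xor (q ∧ q'')) xor ω t u w) xor (((p' ∧ p'') xor (q' ∧ q'')) xor ω t v w)
    ≡⟨ cong₂ _xor_ (form-𝐈²⊞𝐇^ t p q u p'' q'' w) (form-𝐈²⊞𝐇^ t p' q' v p'' q'' w) ⟨
  form (𝐈²⊞𝐇^ t) (p ∷ q ∷ u) (p'' ∷ q'' ∷ w) xor form (𝐈²⊞𝐇^ t) (p' ∷ q' ∷ v) (p'' ∷ q'' ∷ w) ∎
  where
  open xor-∧-Solver
  open ≡-Reasoning
  lin : ∀ p q p' q' p'' q'' r s →
    (((p xor p') ∧ p'') xor ((q xor q') ∧ q'')) xor (r xor s) ≡
    (((p ∧ p'') xor (q ∧ q'')) xor r) xor (((p' ∧ p'') xor (q' ∧ q'')) xor s)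
  lin = solve 8 (λ p q p' q' p'' q'' r s →
      (((p :+ p') :* p'') :+ ((q :+ q') :* q'')) :+ (r :+ s) :=
      (((p :* p'') :+ (q :* q'')) :+ r) :+ (((p' :* p'') :+ (q' :* q'')) :+ s)) refl

Described₂ : ∀ t → Desc t → Vector (𝐈²⊞𝐇^ t) → Set
Described₂ t d (p ∷ q ∷ v) = p ≡ q × Described t d v

described₂? : ∀ t d → Decidable (Described₂ t d)
described₂? t d (p ∷ q ∷ v) = (p ≟ q) ×-dec described? t d v

described₂-maximal : ∀ t d → IsMaxTotallyIsotropic (𝐈²⊞𝐇^ t) (toSubset (described₂? t d))
described₂-maximal t d =
  toSubset-maximal (𝐈²⊞𝐇^ t) (described₂? t d) (refl , described-0 t d) ⊕-closed isotropic coisotropic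
  where
  ⊕-closed : ∀ u v → Described₂ t d u → Described₂ t d v → Described₂ t d (u ⊕ v)
  ⊕-closed (p ∷ q ∷ u) (p' ∷ q' ∷ v) (refl , u∈) (refl , v∈) = refl , described-⊕ t d u v u∈ v∈
  isotropic : ∀ u v → Described₂ t d u → Described₂ t d v → form (𝐈²⊞𝐇^ t) u v ≡ false
  isotropic (p ∷ q ∷ u) (p' ∷ q' ∷ v) (refl , u∈) (refl , v∈) =
    trans (form-𝐈²⊞𝐇^ t p p u p' p' v)
          (trans (cong (_xor ω t u v) (xor-same (p ∧ p'))) (described-isotropic t d u v u∈ v∈))
  coisotropic : ∀ u → (∀ v → Described₂ t d v → form (𝐈²⊞𝐇^ t) u v ≡ false) → Described₂ t d u
  coisotropic (p ∷ q ∷ u) u⊥ =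
    xor≡false⇒≡ (begin
      p xor q                                        ≡⟨ diagonal p q ⟨
      ((p ∧ true) xor (q ∧ true)) xor false          ≡⟨ cong (((p ∧ true) xor (q ∧ true)) xor_) (Ω.β-zeroʳ t u) ⟨
      ((p ∧ true) xor (q ∧ true)) xor ω t u 0ᵛ       ≡⟨ form-𝐈²⊞𝐇^ t p q u true true 0ᵛ ⟨
      form (𝐈²⊞𝐇^ t) (p ∷ q ∷ u) (true ∷ true ∷ 0ᵛ) ≡⟨ u⊥ (true ∷ true ∷ 0ᵛ) (refl , described-0 t d) ⟩
      false                                          ∎) ,
    described-coisotropic t d u λ m m∈ →
      trans (sym (trans (form-𝐈²⊞𝐇^ t p q u false false m) (drop-line p q (ω t u m))))
            (u⊥ (false ∷ false ∷ m) (refl , m∈))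
    where
    open xor-∧-Solver
    open ≡-Reasoning
    diagonal : ∀ p q → ((p ∧ true) xor (q ∧ true)) xor false ≡ p xor q
    diagonal = solve 2 (λ p q → ((p :* con true) :+ (q :* con true)) :+ con false := p :+ q) refl
    drop-line : ∀ p q r → ((p ∧ false) xor (q ∧ false)) xor r ≡ r
    drop-line = solve 3 (λ p q r → ((p :* con false) :+ (q :* con false)) :+ r := r) refl

module MaximalIn𝐈²⊞𝐇^ (t : ℕ) {S : Subset (dim (𝐈²⊞𝐇^ t))} (maximal : IsMaxTotallyIsotropic (𝐈²⊞𝐇^ t) S) where
  private
    ti = proj₁ maximal
    0∈S = proj₁ (proj₁ ti)
    ⊕-closedS = proj₂ (proj₁ ti)
    isotropicS = proj₂ ti

  on-diagonal : ∀ p q v → (p ∷ q ∷ v) ∈ˢ S → p ≡ q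
  on-diagonal p q v w∈ = xor≡false⇒≡ (begin
    p xor q                                  ≡⟨ xor-identityʳ (p xor q) ⟨
    (p xor q) xor false                      ≡⟨ cong₂ (λ a b → (a xor b) xor false) (∧-idem p) (∧-idem q) ⟨
    ((p ∧ p) xor (q ∧ q)) xor false          ≡⟨ cong (((p ∧ p) xor (q ∧ q)) xor_) (ω-self t v) ⟨
    ((p ∧ p) xor (q ∧ q)) xor ω t v v        ≡⟨ form-𝐈²⊞𝐇^ t p q v p q v ⟨
    form (𝐈²⊞𝐇^ t) (p ∷ q ∷ v) (p ∷ q ∷ v)  ≡⟨ isotropicS (p ∷ q ∷ v) (p ∷ q ∷ v) w∈ w∈ ⟩
    false                                    ∎)
    where open ≡-Reasoning

  ∈-maximal : ∀ u → form (𝐈²⊞𝐇^ t) u u ≡ false → (∀ v → v ∈ˢ S → form (𝐈²⊞𝐇^ t) u v ≡ false) → u ∈ˢ S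
  ∈-maximal = maximal-⊥-isotropic⇒∈ (𝐈²⊞𝐇^ t) (form-𝐈²⊞𝐇^-sym t) (form-𝐈²⊞𝐇^-linˡ t) maximal

  -- (1,1,0) is isotropic and orthogonal to every isotropic vector, since those have p = q.
  diagonal∈S : (true ∷ true ∷ 0ᵛ) ∈ˢ S
  diagonal∈S = ∈-maximal (true ∷ true ∷ 0ᵛ)
    (trans (form-𝐈²⊞𝐇^ t true true 0ᵛ true true 0ᵛ) (Ω.β-zeroʳ t 0ᵛ))
    λ { (p ∷ q ∷ v) w∈ → begin
      form (𝐈²⊞𝐇^ t) (true ∷ true ∷ 0ᵛ) (p ∷ q ∷ v) ≡⟨ form-𝐈²⊞𝐇^ t true true 0ᵛ p q v ⟩
      (p xor q) xor ω t 0ᵛ v                         ≡⟨ cong₂ _xor_ (cong (p xor_) (sym (on-diagonal p q v w∈))) (Ω.β-zeroˡ t v) ⟩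
      (p xor p) xor false                            ≡⟨ cong (_xor false) (xor-same p) ⟩
      false                                          ∎ }
    where open ≡-Reasoning

  Q : V t → Set
  Q v = (false ∷ false ∷ v) ∈ˢ S

  over-Q : ∀ p q v → (p ∷ q ∷ v) ∈ˢ S → Q v
  over-Q false q v w∈ = subst (λ q → (false ∷ q ∷ v) ∈ˢ S) (sym (on-diagonal false q v w∈)) w∈
  over-Q true  q v w∈ =
    subst (λ v → Q v) (⊕-identityʳ v)
      (⊕-closedS (true ∷ true ∷ v) (true ∷ true ∷ 0ᵛ)
        (subst (λ q → (true ∷ q ∷ v) ∈ˢ S) (sym (on-diagonal true q v w∈)) w∈) diagonal∈S)

  Q-lagrangian : IsLagrangian t Q
  Q-lagrangian = record
    { 0∈          = 0∈S
    ; ⊕-closed    = λ u v → ⊕-closedS (false ∷ false ∷ u) (false ∷ false ∷ v)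
    ; isotropic   = λ u v u∈ v∈ → trans (sym (form-𝐈²⊞𝐇^ t false false u false false v))
                                      (isotropicS (false ∷ false ∷ u) (false ∷ false ∷ v) u∈ v∈)
    ; coisotropic = λ u u⊥ → ∈-maximal (false ∷ false ∷ u)
        (trans (form-𝐈²⊞𝐇^ t false false u false false u) (ω-self t u))
        (λ { (p ∷ q ∷ v) w∈ → trans (form-𝐈²⊞𝐇^ t false false u p q v) (u⊥ v (over-Q p q v w∈)) })
    }

  described₂ : Σ (Desc t) λ d → S ≡ toSubset (described₂? t d)
  described₂ =
    let d , Q⇔d = describe t Q-lagrangian (λ v → T? (member (false ∷ false ∷ v) S))
        S⊆d : ∀ w → w ∈ˢ S → w ∈ˢ toSubset (described₂? t d)
        S⊆d = λ { (p ∷ q ∷ v) w∈ → ⇔-from (∈-toSubset (described₂? t d) (p ∷ q ∷ v))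
                                     (on-diagonal p q v w∈ , ⇔-to (Q⇔d v) (over-Q p q v w∈)) }
    in d , sym (proj₂ maximal _ (proj₁ (described₂-maximal t d)) S⊆d)

count-𝐈²⊞𝐇^ : ∀ t → HasCount (IsMaxTotallyIsotropic (𝐈²⊞𝐇^ t)) (lagrangianCount t)
count-𝐈²⊞𝐇^ t = subst (HasCount _) (length-allDesc t)
  (count-by-descriptions _ (Described₂ t) (described₂? t) (allDesc t) (allDesc-unique t) (∈-allDesc t)
    (λ d d' d⊆d' → described-injective t d d' λ v v∈ → proj₂ (d⊆d' (false ∷ false ∷ v) (refl , v∈)))
    (described₂-maximal t)
    (λ S maximal → MaximalIn𝐈²⊞𝐇^.described₂ t maximal))

-- The q-Pochhammer identity

toℚᵘ-/ : ∀ a n .{{_ : NonZero n}} → toℚᵘ (+ a ℚ./ n) ≃ᵘ mkℚᵘ (+ a) (pred n)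
toℚᵘ-/ a (suc n) = toℚᵘ-fromℚᵘ (mkℚᵘ (+ a) n)

ℕ→ℚ-+ : ∀ m n → ℕ→ℚ (m + n) ≡ ℕ→ℚ m ℚ.+ ℕ→ℚ n
ℕ→ℚ-+ m n = toℚᵘ-injective (ℚᵘ.≃-trans (toℚᵘ-/ (m + n) 1) (ℚᵘ.≃-sym (begin
  toℚᵘ (ℕ→ℚ m ℚ.+ ℕ→ℚ n)                 ≈⟨ toℚᵘ-homo-+ (ℕ→ℚ m) (ℕ→ℚ n) ⟩
  toℚᵘ (ℕ→ℚ m) ℚᵘ.+ toℚᵘ (ℕ→ℚ n)         ≈⟨ ℚᵘ.+-cong (toℚᵘ-/ m 1) (toℚᵘ-/ n 1) ⟩
  mkℚᵘ (+ m) 0 ℚᵘ.+ mkℚᵘ (+ n) 0         ≈⟨ *≡* (cong (ℤ._* + 1) (trans (cong₂ ℤ._+_ (ℤ.*-identityʳ (+ m)) (ℤ.*-identityʳ (+ n)))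
                                                                 (sym (ℤ.pos-+ m n)))) ⟩
  mkℚᵘ (+ (m + n)) 0                     ∎)))
  where open ℚᵘ.≃-Reasoning

ℕ→ℚ-* : ∀ m n → ℕ→ℚ (m ℕ.* n) ≡ ℕ→ℚ m * ℕ→ℚ n
ℕ→ℚ-* m n = toℚᵘ-injective (ℚᵘ.≃-trans (toℚᵘ-/ (m ℕ.* n) 1) (ℚᵘ.≃-sym (begin
  toℚᵘ (ℕ→ℚ m * ℕ→ℚ n)                 ≈⟨ toℚᵘ-homo-* (ℕ→ℚ m) (ℕ→ℚ n) ⟩
  toℚᵘ (ℕ→ℚ m) ℚᵘ.* toℚᵘ (ℕ→ℚ n)         ≈⟨ ℚᵘ.*-cong (toℚᵘ-/ m 1) (toℚᵘ-/ n 1) ⟩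
  mkℚᵘ (+ m) 0 ℚᵘ.* mkℚᵘ (+ n) 0         ≈⟨ *≡* (cong (ℤ._* + 1) (sym (ℤ.pos-* m n))) ⟩
  mkℚᵘ (+ (m ℕ.* n)) 0                     ∎)))
  where open ℚᵘ.≃-Reasoning

1/n*n≡1 : ∀ n .{{_ : NonZero n}} → (+ 1 ℚ./ n) * ℕ→ℚ n ≡ 1ℚ
1/n*n≡1 n@(suc n-1) = toℚᵘ-injective (begin
  toℚᵘ ((+ 1 ℚ./ n) * ℕ→ℚ n)             ≈⟨ toℚᵘ-homo-* (+ 1 ℚ./ n) (ℕ→ℚ n) ⟩
  toℚᵘ (+ 1 ℚ./ n) ℚᵘ.* toℚᵘ (ℕ→ℚ n)       ≈⟨ ℚᵘ.*-cong (toℚᵘ-/ 1 n) (toℚᵘ-/ n 1) ⟩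
  mkℚᵘ (+ 1) n-1 ℚᵘ.* mkℚᵘ (+ n) 0       ≈⟨ *≡* (cong (λ k → + suc k) (arith n-1)) ⟩
  toℚᵘ 1ℚ                                ∎)
  where
  open ℚᵘ.≃-Reasoning
  arith : ∀ k → (k + 0) ℕ.* 1 ≡ k ℕ.* 1 + 0
  arith = solve-ℕ

1/[m*n]≡1/m*1/n : ∀ m n .{{_ : NonZero m}} .{{_ : NonZero n}} →
                  (+ 1 ℚ./ (m ℕ.* n)) {{ℕ.m*n≢0 m n}} ≡ (+ 1 ℚ./ m) * (+ 1 ℚ./ n)
1/[m*n]≡1/m*1/n m@(suc _) n@(suc _) = toℚᵘ-injective (ℚᵘ.≃-trans (toℚᵘ-/ 1 (m ℕ.* n) {{ℕ.m*n≢0 m n}}) (ℚᵘ.≃-sym (begin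
  toℚᵘ ((+ 1 ℚ./ m) * (+ 1 ℚ./ n))         ≈⟨ toℚᵘ-homo-* (+ 1 ℚ./ m) (+ 1 ℚ./ n) ⟩
  toℚᵘ (+ 1 ℚ./ m) ℚᵘ.* toℚᵘ (+ 1 ℚ./ n)     ≈⟨ ℚᵘ.*-cong (toℚᵘ-/ 1 m) (toℚᵘ-/ 1 n) ⟩
  mkℚᵘ (+ 1) (pred (m ℕ.* n))              ∎)))
  where open ℚᵘ.≃-Reasoning

4^n≡2^n*2^n : ∀ n → 4 ^ n ≡ 2 ^ n ℕ.* 2 ^ n
4^n≡2^n*2^n n = begin
  4 ^ n            ≡⟨ ℕ.^-*-assoc 2 2 n ⟩
  2 ^ (2 ℕ.* n)      ≡⟨ ℕ.^-distribˡ-+-* 2 n (n + 0) ⟩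
  2 ^ n ℕ.* 2 ^ (n + 0) ≡⟨ cong (λ k → 2 ^ n ℕ.* 2 ^ k) (ℕ.+-identityʳ n) ⟩
  2 ^ n ℕ.* 2 ^ n    ∎
  where open ≡-Reasoning

triangle-suc : ∀ t → (suc (suc t) ℕ.* suc t) ℕ./ 2 ≡ (suc t ℕ.* t) ℕ./ 2 + suc t
triangle-suc t = begin
  (suc (suc t) ℕ.* suc t) ℕ./ 2          ≡⟨ cong (ℕ._/ 2) (expand t) ⟩
  (suc t ℕ.* t + suc t ℕ.* 2) ℕ./ 2        ≡⟨ ℕ.+-distrib-/-∣ʳ (suc t ℕ.* t) (divides (suc t) refl) ⟩
  (suc t ℕ.* t) ℕ./ 2 + (suc t ℕ.* 2) ℕ./ 2  ≡⟨ cong (λ k → (suc t ℕ.* t) ℕ./ 2 + k) (ℕ.m*n/n≡m (suc t) 2) ⟩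
  (suc t ℕ.* t) ℕ./ 2 + suc t            ∎
  where
  open ≡-Reasoning
  expand : ∀ t → suc (suc t) ℕ.* suc t ≡ suc t ℕ.* t + suc t ℕ.* 2
  expand = solve-ℕ

twoPowTri-suc : ∀ t → twoPowTri (suc t) ≡ twoPowTri t * ℕ→ℚ (2 ^ suc t)
twoPowTri-suc t = begin
  ℕ→ℚ (2 ^ ((suc (suc t) ℕ.* suc t) ℕ./ 2))                 ≡⟨ cong (λ k → ℕ→ℚ (2 ^ k)) (triangle-suc t) ⟩
  ℕ→ℚ (2 ^ ((suc t ℕ.* t) ℕ./ 2 + suc t))                   ≡⟨ cong ℕ→ℚ (ℕ.^-distribˡ-+-* 2 ((suc t ℕ.* t) ℕ./ 2) (suc t)) ⟩
  ℕ→ℚ (2 ^ ((suc t ℕ.* t) ℕ./ 2) ℕ.* 2 ^ suc t)               ≡⟨ ℕ→ℚ-* (2 ^ ((suc t ℕ.* t) ℕ./ 2)) (2 ^ suc t) ⟩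
  ℕ→ℚ (2 ^ ((suc t ℕ.* t) ℕ./ 2)) * ℕ→ℚ (2 ^ suc t)      ∎
  where open ≡-Reasoning

-- With a = 2^(t+1) and x = 1/a: (1 + a)(1 - x) = a - x = a (1 - x²).
pochhammer-step : ∀ a x → x * a ≡ 1ℚ → (1ℚ ℚ.+ a) * (1ℚ ℚ.- x) ≡ a * (1ℚ ℚ.- x * x)
pochhammer-step a x xa≡1 = begin
  (1ℚ ℚ.+ a) * (1ℚ ℚ.- x)                                  ≡⟨ split a x ⟩
  a * (1ℚ ℚ.- x * x) ℚ.+ (1ℚ ℚ.- x * a) * (1ℚ ℚ.- x) ≡⟨ cong (λ y → a * (1ℚ ℚ.- x * x) ℚ.+ (1ℚ ℚ.- y) * (1ℚ ℚ.- x)) xa≡1 ⟩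
  a * (1ℚ ℚ.- x * x) ℚ.+ (1ℚ ℚ.- 1ℚ) * (1ℚ ℚ.- x)     ≡⟨ vanish a x ⟩
  a * (1ℚ ℚ.- x * x)                                     ∎
  where
  open +-*-Solver
  open ≡-Reasoning
  split : ∀ a x → (1ℚ ℚ.+ a) * (1ℚ ℚ.- x) ≡ a * (1ℚ ℚ.- x * x) ℚ.+ (1ℚ ℚ.- x * a) * (1ℚ ℚ.- x)
  split = solve 2 (λ a x →
      (con 1ℚ :+ a) :* (con 1ℚ :- x) :=
      a :* (con 1ℚ :- x :* x) :+ (con 1ℚ :- x :* a) :* (con 1ℚ :- x)) refl
  vanish : ∀ a x → a * (1ℚ ℚ.- x * x) ℚ.+ (1ℚ ℚ.- 1ℚ) * (1ℚ ℚ.- x) ≡ a * (1ℚ ℚ.- x * x)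
  vanish = solve 2 (λ a x →
      a :* (con 1ℚ :- x :* x) :+ (con 1ℚ :- con 1ℚ) :* (con 1ℚ :- x) :=
      a :* (con 1ℚ :- x :* x)) refl

lagrangianCount-pochhammer : ∀ t → ℕ→ℚ (lagrangianCount t) * qPoch 2 t ≡ twoPowTri t * qPoch 4 t
lagrangianCount-pochhammer zero    = refl
lagrangianCount-pochhammer (suc t) = begin
  ℕ→ℚ (suc A ℕ.* N) * (P₂ * (1ℚ ℚ.- x))
    ≡⟨ cong (_* (P₂ * (1ℚ ℚ.- x))) (trans (ℕ→ℚ-* (suc A) N) (cong (_* ℕ→ℚ N) (ℕ→ℚ-+ 1 A))) ⟩
  ((1ℚ ℚ.+ a) * ℕ→ℚ N) * (P₂ * (1ℚ ℚ.- x))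
    ≡⟨ regroup (1ℚ ℚ.+ a) (ℕ→ℚ N) P₂ (1ℚ ℚ.- x) ⟩
  (ℕ→ℚ N * P₂) * ((1ℚ ℚ.+ a) * (1ℚ ℚ.- x))
    ≡⟨ cong₂ _*_ (lagrangianCount-pochhammer t) (pochhammer-step a x (1/n*n≡1 A)) ⟩
  (Tri * P₄) * (a * (1ℚ ℚ.- x * x))
    ≡⟨ regroup' Tri P₄ a (1ℚ ℚ.- x * x) ⟩
  (Tri * a) * (P₄ * (1ℚ ℚ.- x * x))
    ≡⟨ cong₂ (λ u y → u * (P₄ * (1ℚ ℚ.- y))) (twoPowTri-suc t) y≡x*x ⟨
  twoPowTri (suc t) * (P₄ * (1ℚ ℚ.- y))  ∎
  where
  open +-*-Solver
  open ≡-Reasoning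
  A = 2 ^ suc t
  N = lagrangianCount t
  instance
    A≢0 : NonZero A
    A≢0 = ℕ.m^n≢0 2 (suc t)
  a = ℕ→ℚ A
  x = + 1 ℚ./ A
  y = (+ 1 ℚ./ (4 ^ suc t)) {{ℕ.m^n≢0 4 (suc t)}}
  P₂ = qPoch 2 t
  P₄ = qPoch 4 t
  Tri = twoPowTri t
  y≡x*x : y ≡ x * x
  y≡x*x = trans (ℚ./-cong {+ 1} {4 ^ suc t} {+ 1} {A ℕ.* A} {{ℕ.m^n≢0 4 (suc t)}} {{ℕ.m*n≢0 A A}}
                          refl (4^n≡2^n*2^n (suc t)))
                (1/[m*n]≡1/m*1/n A A)
  regroup : ∀ b c p q → (b * c) * (p * q) ≡ (c * p) * (b * q)
  regroup = solve 4 (λ b c p q → (b :* c) :* (p :* q) := (c :* p) :* (b :* q)) refl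
  regroup' : ∀ b c p q → (b * c) * (p * q) ≡ (b * p) * (c * q)
  regroup' = solve 4 (λ b c p q → (b :* c) :* (p :* q) := (b :* p) :* (c :* q)) refl

lemma4p7 : (t : ℕ) →
    (Σ ℕ λ N → HasCount (IsMaxTotallyIsotropic (𝐇 ^⊞ t)) N
                × ℕ→ℚ N * qPoch 2 t ≡ twoPowTri t * qPoch 4 t)
    × (Σ ℕ λ N → HasCount (IsMaxTotallyIsotropic ((𝐈 ⊞ 𝐈) ⊞ (𝐇 ^⊞ t))) N
                × ℕ→ℚ N * qPoch 2 t ≡ twoPowTri t * qPoch 4 t)
lemma4p7 t = (lagrangianCount t , count-𝐇^⊞ t , lagrangianCount-pochhammer t)
           , (lagrangianCount t , count-𝐈²⊞𝐇^ t , lagrangianCount-pochhammer t)
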